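{- Let $G$ be a connected graph (no loops, no multiple edges), $b\in V_G$, $\ell\in\mathbb{Z}_{\ge0}$. For $\langle\mathbf{p},a\rangle\in\operatorname{IP}_{G,b,\ell}$ define $L_{\langle\mathbf{p},a\rangle}:[1,\#\mathbf{p}]\to\mathbb{Z}_{\ge0}$ by $L_{\langle\mathbf{p},a\rangle}(r)=d_{\mathbf{p}}(r)+a-1$. Then $(\mathbf{p},L_{\langle\mathbf{p},a\rangle})$ is a $(G,b,\ell)$-tableau, so $\langle\mathbf{p},a\rangle\mapsto(\mathbf{p},L_{\langle\mathbf{p},a\rangle})$ is a well-defined map $\tau:\operatorname{IP}_{G,b,\ell}\to\operatorname{Tab}_{G,b,\ell}$.
   Context: $G$-paths: a $G$-path $\mathbf{p}$ has length $\#\mathbf{p}$, edges $\mathbf{p}_i=\{p_{i-1},p_i\}\in E_G$ ($1\le i\le\#\mathbf{p}$) and vertices $p_0,\dots,p_{\#\mathbf{p}}$; it starts at $b$ if $p_0=b$. It is cycle-free if its vertices are distinct. For $\#\mathbf{p}>0$, the maximal-length cycle-free suffix decomposition is the unique factorization $\mathbf{p}=\mathbf{p}^{(1)}\cdots\mathbf{p}^{(n_{\mathbf{p}})}$ into positive-length paths (concatenation) such that each $\mathbf{p}^{(t)}$ is the longest cycle-free suffix of $\mathbf{p}^{(1)}\cdots\mathbf{p}^{(t)}$; $d_{\mathbf{p}}(r)$ is the index $t$ of the block $\mathbf{p}^{(t)}$ containing the $r$-th edge of $\mathbf{p}$. $\operatorname{IP}_{G,b,\ell}$ is the set of pairs $\langle\mathbf{p},a\rangle$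 with $\mathbf{p}$ a $G$-path from $b$ with $\#\mathbf{p}>0$ and $a\in\mathbb{Z}$, $0\le a\le\ell+1-\#\mathbf{p}-n_{\mathbf{p}}$. A $(G,b,\ell)$-tableau is a pair $(\mathbf{p},L)$ with $\mathbf{p}$ a $G$-path starting at $b$ (possibly of length $0$) and $L:[1,\#\mathbf{p}]\to\mathbb{Z}_{\ge0}$ such that (i) $L(i)\le L(j)$ for $i\le j$; (ii) if $i<j$ and $p_{i-1}=p_j$ then $L(i)<L(j)$; (iii) $L(\#\mathbf{p})+\#\mathbf{p}\le\ell$. $\operatorname{Tab}_{G,b,\ell}$ is the set of these. -}

module Defs where

open import Data.Nat using (ℕ; zero; suc; _+_; _∸_; _≤_; _<_)
open import Data.Fin using (Fin)
open import Data.Product using (Σ; _×_; ∃)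
open import Relation.Binary.PropositionalEquality using (_≡_; _≢_)
open import Relation.Nullary using (¬_)
open import Relation.Nullary.Decidable using (Dec; yes; no)

record Graph : Set₁ where
  field
    m     : ℕ
    Adj   : Fin m → Fin m → Set
    sym   : ∀ {u v} → Adj u v → Adj v u
    irrefl : ∀ {u} → ¬ Adj u u

open Graph public

-- A G-path of length k, given by its vertex sequence p 0, ..., p k
-- (values of p beyond k are irrelevant); consecutive vertices adjacent.
IsPath : (G : Graph) → ℕ → (ℕ → Fin (m G)) → Set
IsPath G k p = ∀ i → i < k → Adj G (p i) (p (suc i))

IsPathFrom : (G : Graph) → Fin (m G) → ℕ → (ℕ → Fin (m G)) → Set
IsPathFrom G b k p = p 0 ≡ b × IsPath G k p

Connected : Graph → Set
Connected G = ∀ u v → Σ ℕ λ k → Σ (ℕ → Fin (m G)) λ p →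
  IsPathFrom G u k p × p k ≡ v

CycleFreeSeg : {V : Set} → (ℕ → V) → ℕ → ℕ → Set
CycleFreeSeg p s e = ∀ i j → s ≤ i → i < j → j ≤ e → p i ≢ p j

-- The maximal-length cycle-free suffix decomposition p = p^(1) ⋯ p^(n) of a
-- path p of length k, encoded by cut points c 0 = 0 < c 1 < ⋯ < c n = k:
-- block p^(t) (1 ≤ t ≤ n) is the sub-path with vertices p (c (t-1)), ..., p (c t).
-- Each block has positive length, is cycle-free, and is the longest cycle-free
-- suffix of p^(1)⋯p^(t) (no longer suffix, starting at s < c (t-1), is cycle-free).
IsMaxCFSuffixDecomp : {V : Set} → (ℕ → V) → ℕ → ℕ → (ℕ → ℕ) → Set
IsMaxCFSuffixDecomp p k n c =
  c 0 ≡ 0 × c n ≡ k ×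
  (∀ t → t < n → c t < c (suc t)) ×
  (∀ t → t < n → CycleFreeSeg p (c t) (c (suc t))) ×
  (∀ t → t < n → ∀ s → s < c t → ¬ CycleFreeSeg p s (c (suc t)))

countBelow : (ℕ → ℕ) → ℕ → ℕ → ℕ
countBelow c zero r = 0
countBelow c (suc n) r with c n Data.Nat.<? r
... | yes _ = suc (countBelow c n r)
... | no _ = countBelow c n r

-- d_p(r): index t of the block containing the r-th edge, i.e. the t with
-- c (t-1) < r ≤ c t, which equals #{ t < n | c t < r }.
blockIndex : (ℕ → ℕ) → ℕ → ℕ → ℕ
blockIndex c n r = countBelow c n r

IsTableau : (G : Graph) → Fin (m G) → ℕ → ℕ → (ℕ → Fin (m G)) → (ℕ → ℕ) → Set
IsTableau G b ℓ k p L =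
  IsPathFrom G b k p ×
  (∀ i j → 1 ≤ i → i ≤ j → j ≤ k → L i ≤ L j) ×
  (∀ i j → 1 ≤ i → i < j → j ≤ k → p (i ∸ 1) ≡ p j → L i < L j) ×
  (1 ≤ k → L k + k ≤ ℓ)

{-# OPTIONS --safe #-}
module Submission where

open import Defs
open import Data.Nat using (ℕ; zero; suc; z<s; _+_; _∸_; _≤_; _<_; _<?_; _≤?_; z≤n)
open import Data.Nat.Properties
open import Data.Fin using (Fin)
open import Data.Product using (Σ; _×_; _,_)
open import Data.Sum using (inj₁; inj₂)
open import Data.Empty using (⊥-elim)
open import Relation.Nullary using (yes; no)
open import Relation.Binary.PropositionalEquality using (_≡_; refl)

-- d_p(r) + a − 1 is the block index d_p(r) (at least 1, at most n) shifted by a, so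
-- monotonicity and the length bound are counting facts about the cuts.  If
-- p (i − 1) = p j with i < j, the two edges cannot lie in one block, since every
-- block is cycle-free; hence a cut c t lies in [i, j) and d_p(i) < d_p(j).

indicator< : ℕ → ℕ → ℕ
indicator< x y with x <? y
... | yes _ = 1
... | no _ = 0

indicator<-mono : ∀ x {i j} → i ≤ j → indicator< x i ≤ indicator< x j
indicator<-mono x {i} {j} i≤j with x <? i | x <? j
... | yes _   | yes _   = ≤-refl
... | yes x<i | no x≮j  = ⊥-elim (x≮j (<-≤-trans x<i i≤j))
... | no _    | _       = z≤n

indicator<-≤ : ∀ x y → indicator< x y ≤ 1
indicator<-≤ x y with x <? y
... | yes _ = ≤-refl
... | no _ = z≤n

indicator<-cut : ∀ {x i j} → i ≤ x → x < j → indicator< x i < indicator< x j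
indicator<-cut {x} {i} {j} i≤x x<j with x <? i | x <? j
... | yes x<i | _       = ⊥-elim (<-irrefl refl (<-≤-trans x<i i≤x))
... | no _    | yes _   = ≤-refl
... | no _    | no x≮j  = ⊥-elim (x≮j x<j)

countBelow-suc : ∀ c n r → countBelow c (suc n) r ≡ indicator< (c n) r + countBelow c n r
countBelow-suc c n r with c n <? r
... | yes _ = refl
... | no _ = refl

countBelow-mono : ∀ c n {i j} → i ≤ j → countBelow c n i ≤ countBelow c n j
countBelow-mono c zero i≤j = z≤n
countBelow-mono c (suc n) {i} {j} i≤j
  rewrite countBelow-suc c n i | countBelow-suc c n j =
  +-mono-≤ (indicator<-mono (c n) i≤j) (countBelow-mono c n i≤j)

countBelow-≤ : ∀ c n r → countBelow c n r ≤ n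
countBelow-≤ c zero r = z≤n
countBelow-≤ c (suc n) r rewrite countBelow-suc c n r =
  +-mono-≤ (indicator<-≤ (c n) r) (countBelow-≤ c n r)

countBelow-cut : ∀ c n {t i j} → t < n → i ≤ c t → c t < j →
  countBelow c n i < countBelow c n j
countBelow-cut c (suc n) {t} {i} {j} t<1+n i≤ct ct<j
  rewrite countBelow-suc c n i | countBelow-suc c n j
  with m<1+n⇒m<n∨m≡n t<1+n
... | inj₁ t<n = +-mono-≤-< (indicator<-mono (c n) (<⇒≤ (≤-<-trans i≤ct ct<j)))
  (countBelow-cut c n t<n i≤ct ct<j)
... | inj₂ refl = +-mono-<-≤ (indicator<-cut i≤ct ct<j)
  (countBelow-mono c n (<⇒≤ (≤-<-trans i≤ct ct<j)))

cut-between-repeat : ∀ {V : Set} (p : ℕ → V) (c : ℕ → ℕ) n →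
  (∀ t → t < n → CycleFreeSeg p (c t) (c (suc t))) →
  ∀ {i j} → c 0 < i → i < j → j ≤ c n → p (i ∸ 1) ≡ p j →
  Σ ℕ λ t → t < n × i ≤ c t × c t < j
cut-between-repeat p c zero cf c0<i i<j j≤c0 eq =
  ⊥-elim (<-irrefl refl (<-≤-trans (<-trans c0<i i<j) j≤c0))
cut-between-repeat p c (suc n) cf {i} {j} c0<i i<j j≤c[1+n] eq with j ≤? c n
... | yes j≤cn =
  let t , t<n , i≤ct , ct<j =
        cut-between-repeat p c n (λ t t<n → cf t (m<n⇒m<1+n t<n)) c0<i i<j j≤cn eq
  in t , m<n⇒m<1+n t<n , i≤ct , ct<j
... | no j≰cn with i ≤? c n
...   | yes i≤cn = n , n<1+n n , i≤cn , ≰⇒> j≰cn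
...   | no i≰cn = ⊥-elim (cf n (n<1+n n) (i ∸ 1) j
          (<⇒≤pred (≰⇒> i≰cn)) (≤-<-trans (m∸n≤m i 1) i<j) j≤c[1+n] eq)

cuts-nonempty : ∀ (c : ℕ → ℕ) n {r} → c 0 < r → r ≤ c n → 0 < n
cuts-nonempty c zero c0<r r≤c0 = ⊥-elim (<-irrefl refl (<-≤-trans c0<r r≤c0))
cuts-nonempty c (suc n) _ _ = z<s

lemma3p4 : (G : Graph) → Connected G → (b : Fin (m G)) → (ℓ : ℕ) →
    (k : ℕ) → (p : ℕ → Fin (m G)) → IsPathFrom G b k p → 1 ≤ k →
    (n : ℕ) → (c : ℕ → ℕ) → IsMaxCFSuffixDecomp p k n c →
    (a : ℕ) → a + k + n ≤ ℓ + 1 →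
    IsTableau G b ℓ k p (λ r → blockIndex c n r + a ∸ 1)
lemma3p4 G _ b ℓ k p path 1≤k n c (c0≡0 , cn≡k , _ , cycleFree , _) a bound =
  path , monotone , strict , lengthBound
  where
  c0<_ : ∀ {r} → 1 ≤ r → c 0 < r
  c0< 1≤r rewrite c0≡0 = 1≤r

  ≤cn : ∀ {r} → r ≤ k → r ≤ c n
  ≤cn r≤k rewrite cn≡k = r≤k

  index-pos : ∀ {r} → 1 ≤ r → r ≤ k → 1 ≤ countBelow c n r
  index-pos 1≤r r≤k = ≤-<-trans z≤n
    (countBelow-cut c n (cuts-nonempty c n (c0< 1≤r) (≤cn r≤k)) z≤n (c0< 1≤r))

  monotone : ∀ i j → 1 ≤ i → i ≤ j → j ≤ k →
    countBelow c n i + a ∸ 1 ≤ countBelow c n j + a ∸ 1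
  monotone i j _ i≤j _ = ∸-monoˡ-≤ 1 (+-monoˡ-≤ a (countBelow-mono c n i≤j))

  strict : ∀ i j → 1 ≤ i → i < j → j ≤ k → p (i ∸ 1) ≡ p j →
    countBelow c n i + a ∸ 1 < countBelow c n j + a ∸ 1
  strict i j 1≤i i<j j≤k repeat
    with cut-between-repeat p c n cycleFree (c0< 1≤i) i<j (≤cn j≤k) repeat
  ... | _ , t<n , i≤ct , ct<j =
    ∸-monoˡ-< (+-monoˡ-< a (countBelow-cut c n t<n i≤ct ct<j))
      (≤-trans (index-pos 1≤i (<⇒≤ (<-≤-trans i<j j≤k))) (m≤m+n _ a))

  lengthBound : 1 ≤ k → countBelow c n k + a ∸ 1 + k ≤ ℓ
  lengthBound _ = begin
    countBelow c n k + a ∸ 1 + k  ≡⟨ +-∸-comm k (≤-trans (index-pos 1≤k ≤-refl) (m≤m+n _ a)) ⟨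
    countBelow c n k + a + k ∸ 1  ≤⟨ pred-mono-≤ (begin
      countBelow c n k + a + k      ≤⟨ +-monoˡ-≤ k (+-monoˡ-≤ a (countBelow-≤ c n k)) ⟩
      n + a + k                     ≡⟨ +-assoc n a k ⟩
      n + (a + k)                   ≡⟨ +-comm n (a + k) ⟩
      a + k + n                     ≤⟨ bound ⟩
      ℓ + 1                         ≡⟨ +-comm ℓ 1 ⟩
      suc ℓ                         ∎) ⟩
    ℓ                             ∎
    where open ≤-Reasoning
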